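{- Let $F$ be a clause-set and $P\subseteq\mathrm{prc}_0(F)$ the set of essential prime implicates of $F$. Then for every clause-set $F'$ equivalent to $F$ there is an injection $i:P\to F'$ with $C\subseteq i(C)$ for all $C\in P$. In particular $c(F')\ge c(P)$.
   Context: Clauses are finite sets of literals without complementary pair; clause-sets finite sets of clauses; $c(F)=|F|$. $\mathrm{prc}_0(F)$: the prime implicates of $F$, i.e. clauses $C$ with $F\models C$ such that no proper subset of $C$ is implied by $F$. Two clause-sets are equivalent iff they have the same prime implicates. A prime implicate $C$ of $F$ is essential if $\mathrm{prc}_0(F)\setminus\{C\}$ is not equivalent to $F$. -}

module Defs where

open import Data.Nat using (ℕ)
open import Data.Bool using (Bool; not)
open import Data.List using (List; length)
open import Data.List.Membership.Propositional using (_∈_)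
open import Data.List.Relation.Unary.Unique.Propositional using (Unique)
open import Data.List.Relation.Unary.All using (All)
open import Data.List.Relation.Unary.AllPairs using (AllPairs)
open import Data.List.Relation.Unary.Any using (Any)
open import Data.Product using (_×_)
open import Relation.Nullary using (¬_)
open import Function.Bundles using (_⇔_)
open import Relation.Binary.PropositionalEquality using (_≡_)

-- Variables are natural numbers; a literal is a variable with a sign
-- (sign true = positive literal v, sign false = negative literal ¬v).
Var : Set
Var = ℕ

record Lit : Set where
  constructor lit
  field
    var  : Var
    sign : Bool

comp : Lit → Lit
comp (lit v s) = lit v (not s)

_⊆_ : List Lit → List Lit → Set
C ⊆ D = ∀ x → x ∈ C → x ∈ D

_≈_ : List Lit → List Lit → Set
C ≈ D = (C ⊆ D) × (D ⊆ C)

IsClause : List Lit → Set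
IsClause C = Unique C × (∀ x → x ∈ C → ¬ (comp x ∈ C))

Assignment : Set
Assignment = Var → Bool

evalLit : Assignment → Lit → Set
evalLit φ (lit v s) = φ v ≡ s

satC : Assignment → List Lit → Set
satC φ C = Any (evalLit φ) C

CSet : Set₁
CSet = List Lit → Set

satS : Assignment → CSet → Set
satS φ S = ∀ C → S C → satC φ C

_⊨_ : CSet → List Lit → Set
S ⊨ C = ∀ φ → satS φ S → satC φ C

IsPrime : CSet → List Lit → Set
IsPrime S C = IsClause C × (S ⊨ C) × (∀ D → D ⊆ C → ¬ (C ⊆ D) → ¬ (S ⊨ D))

Equiv : CSet → CSet → Set
Equiv S T = ∀ C → IsPrime S C ⇔ IsPrime T C

record ClauseSet : Set where
  field
    clauses  : List (List Lit)
    allCl    : All IsClause clauses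
    distinct : AllPairs (λ C D → ¬ (C ≈ D)) clauses
open ClauseSet public

⟦_⟧ : ClauseSet → CSet
⟦ F ⟧ C = C ∈ clauses F

c : ClauseSet → ℕ
c F = length (clauses F)

prcMinus : ClauseSet → List Lit → CSet
prcMinus F C D = IsPrime ⟦ F ⟧ D × ¬ (D ≈ C)

Essential : ClauseSet → List Lit → Set
Essential F C = IsPrime ⟦ F ⟧ C × ¬ Equiv (prcMinus F C) ⟦ F ⟧

-- Call C avoidable in X if some implicate of F inside X does not contain C.  If an
-- essential prime implicate C were avoidable in every clause X of F′, each such X
-- would contain a prime implicate of F other than C; then prc₀(F) ∖ {C} would imply
-- F′, hence F, and so be equivalent to F.  Hence C is unavoidable in some X ∈ F′,
-- which we take as i(C); it contains C since X is itself an implicate of F.  If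
-- i(C) = i(D), then D is an implicate of F inside i(C), so C ⊆ D, and symmetrically.
-- The argument is constructive because unavoidability is decidable: entailment
-- depends on finitely many variables, and the sub-clauses of X can be enumerated.
module Submission where

open import Defs
open import Data.Nat using (_≤_; _<_; suc; z≤n; s≤s)
open import Data.Nat.Induction using (<-wellFounded)
import Data.Nat.Properties as ℕ
open import Data.Bool as Bool using (Bool; true; false)
open import Data.List using (List; []; _∷_; length; map; _++_; filter; concatMap)
open import Data.List.Properties using (filter-notAll)
open import Data.List.Membership.Propositional using (_∈_; find; lose)
open import Data.List.Membership.Propositional.Properties
  using (∈-filter⁺; ∈-filter⁻; ∈-map⁺; ∈-++⁺ˡ; ∈-++⁺ʳ; ∈-++⁻; ∈-map⁻; ∈-concat⁺′)
open import Data.List.Relation.Unary.All using (All; []; _∷_; all?; lookup; tabulate; reduce)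
open import Data.List.Relation.Unary.All.Properties using (¬All⇒Any¬)
open import Data.List.Relation.Unary.AllPairs using (AllPairs; []; _∷_)
open import Data.List.Relation.Unary.Any using (here; there; any?)
import Data.List.Relation.Unary.Unique.Propositional.Properties as Unique
open import Data.Product using (Σ; _×_; _,_; proj₁; proj₂)
open import Data.Sum using (_⊎_; inj₁; inj₂)
open import Data.Empty using (⊥-elim)
open import Function.Bundles using (Equivalence; mk⇔)
import Function.Properties.Equivalence as ⇔
open import Induction.WellFounded using (Acc; acc)
open import Relation.Nullary using (¬_; Dec; yes; no; does; ¬?)
open import Relation.Nullary.Decidable using (decidable-stable; map′; _×-dec_; _→-dec_)
open import Relation.Binary.Definitions using (DecidableEquality)
open import Relation.Binary.PropositionalEquality using (_≡_; _≢_; refl; sym; trans; cong; subst)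

sublists : ∀ {A : Set} → List A → List (List A)
sublists []       = [] ∷ []
sublists (x ∷ xs) = map (x ∷_) (sublists xs) ++ sublists xs

filter∈sublists : ∀ {A : Set} {P : A → Set} (P? : ∀ x → Dec (P x)) xs →
                  filter P? xs ∈ sublists xs
filter∈sublists P? []       = here refl
filter∈sublists P? (x ∷ xs) with does (P? x)
... | true  = ∈-++⁺ˡ (∈-map⁺ (x ∷_) (filter∈sublists P? xs))
... | false = ∈-++⁺ʳ (map (x ∷_) (sublists xs)) (filter∈sublists P? xs)

∈sublists⇒⊆ : ∀ {E} X → E ∈ sublists X → E ⊆ X
∈sublists⇒⊆ [] (here refl) _ ()
∈sublists⇒⊆ (x ∷ xs) E∈ with ∈-++⁻ (map (x ∷_) (sublists xs)) E∈
... | inj₂ E∈′ = λ y y∈ → there (∈sublists⇒⊆ xs E∈′ y y∈)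
... | inj₁ xE∈ with E′ , E′∈ , refl ← ∈-map⁻ (x ∷_) xE∈ =
  λ { y (here refl) → here refl ; y (there y∈) → there (∈sublists⇒⊆ xs E′∈ y y∈) }

remove-∈ : ∀ {A : Set} {y : A} {zs} → y ∈ zs →
           Σ (List A) λ zs′ → suc (length zs′) ≡ length zs × (∀ z → z ∈ zs → z ≢ y → z ∈ zs′)
remove-∈ {zs = z ∷ zs} (here refl) =
  zs , refl , λ { w (here refl) w≢z → ⊥-elim (w≢z refl) ; w (there w∈) _ → w∈ }
remove-∈ {zs = z ∷ zs} (there y∈) with zs′ , len , keep ← remove-∈ y∈ =
  z ∷ zs′ , cong suc len , λ { w (here refl) _ → here refl ; w (there w∈) w≢y → there (keep w w∈ w≢y) }

Unique-length-≤ : ∀ {A : Set} {ys zs : List A} → AllPairs _≢_ ys → All (_∈ zs) ys →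
                  length ys ≤ length zs
Unique-length-≤ [] [] = z≤n
Unique-length-≤ {ys = y ∷ ys} (y∉ys ∷ unique) (y∈zs ∷ ys⊆zs)
  with zs′ , suc|zs′|≡|zs| , keep ← remove-∈ y∈zs =
  subst (suc (length ys) ≤_) suc|zs′|≡|zs|
    (s≤s (Unique-length-≤ unique
      (tabulate λ {w} w∈ys → keep w (lookup ys⊆zs w∈ys) λ w≡y → lookup y∉ys w∈ys (sym w≡y))))

module _ {A B : Set} {P : A → Set} (f : ∀ {x} → P x → B) where

  length-reduce : ∀ {xs} (pxs : All P xs) → length (reduce f pxs) ≡ length xs
  length-reduce []         = refl
  length-reduce (px ∷ pxs) = cong suc (length-reduce pxs)

  reduce-All : ∀ {T : B → Set} → (∀ {x} (px : P x) → T (f px)) →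
               ∀ {xs} (pxs : All P xs) → All T (reduce f pxs)
  reduce-All t []         = []
  reduce-All t (px ∷ pxs) = t px ∷ reduce-All t pxs

  reduce-AllPairs : ∀ {R : A → A → Set} {S : B → B → Set} →
                    (∀ {x y} (px : P x) (py : P y) → R x y → S (f px) (f py)) →
                    ∀ {xs} (pxs : All P xs) → AllPairs R xs → AllPairs S (reduce f pxs)
  reduce-AllPairs {R} {S} s []         []         = []
  reduce-AllPairs {R} {S} s (px ∷ pxs) (Rx ∷ Rs) = head pxs Rx ∷ reduce-AllPairs s pxs Rs
    where
    head : ∀ {x ys} {px : P x} (pys : All P ys) → All (R x) ys → All (S (f px)) (reduce f pys)
    head []         []         = []
    head (py ∷ pys) (Rxy ∷ Rs) = s _ py Rxy ∷ head pys Rs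

  injection⇒length-≤ : ∀ {_~_ : A → A → Set} {zs} → (∀ {x} (px : P x) → f px ∈ zs) →
                       (∀ {x y} (px : P x) (py : P y) → f px ≡ f py → x ~ y) →
                       ∀ {xs} → AllPairs (λ x y → ¬ x ~ y) xs → All P xs → length xs ≤ length zs
  injection⇒length-≤ f∈zs injective distinct pxs =
    subst (_≤ _) (length-reduce pxs)
      (Unique-length-≤ (reduce-AllPairs (λ px py x≁y fx≡fy → x≁y (injective px py fx≡fy)) pxs distinct)
                       (reduce-All f∈zs pxs))

_≟ˡ_ : DecidableEquality Lit
lit v s ≟ˡ lit w t =
  map′ (λ { (refl , refl) → refl }) (λ { refl → refl , refl }) ((v ℕ.≟ w) ×-dec (s Bool.≟ t))

open import Data.List.Membership.DecPropositional _≟ˡ_ using (_∈?_)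

⊆-refl : ∀ {C} → C ⊆ C
⊆-refl _ x∈ = x∈

⊆-trans : ∀ {C D E} → C ⊆ D → D ⊆ E → C ⊆ E
⊆-trans C⊆D D⊆E x x∈ = D⊆E x (C⊆D x x∈)

≡⇒≈ : ∀ {C D} → C ≡ D → C ≈ D
≡⇒≈ refl = ⊆-refl , ⊆-refl

_⊆?_ : (C D : List Lit) → Dec (C ⊆ D)
C ⊆? D = map′ (λ all _ → lookup all) (λ C⊆D → tabulate (C⊆D _)) (all? (_∈? D) C)

restrict : List Lit → List Lit → List Lit
restrict X E = filter (_∈? E) X

restrict-⊆ˡ : ∀ X E → restrict X E ⊆ X
restrict-⊆ˡ X E x x∈ = proj₁ (∈-filter⁻ (_∈? E) x∈)

restrict-⊆ʳ : ∀ X E → restrict X E ⊆ E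
restrict-⊆ʳ X E x x∈ = proj₂ (∈-filter⁻ (_∈? E) {xs = X} x∈)

⊆-restrict : ∀ {X E} → E ⊆ X → E ⊆ restrict X E
⊆-restrict E⊆X x x∈ = ∈-filter⁺ (_∈? _) (E⊆X x x∈) x∈

restrict-clause : ∀ {X} E → IsClause X → IsClause (restrict X E)
restrict-clause {X} E (unique , consistent) =
  Unique.filter⁺ (_∈? E) unique ,
  λ x x∈ x̄∈ → consistent x (restrict-⊆ˡ X E x x∈) (restrict-⊆ˡ X E _ x̄∈)

restrict-< : ∀ {X E} → ¬ X ⊆ E → length (restrict X E) < length X
restrict-< {X} {E} X⊈E =
  filter-notAll (_∈? E) X (¬All⇒Any¬ (_∈? E) X λ all → X⊈E λ _ → lookup all)

satC? : ∀ φ C → Dec (satC φ C)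
satC? φ C = any? (λ { (lit v s) → φ v Bool.≟ s }) C

satC-mono : ∀ {φ C D} → C ⊆ D → satC φ C → satC φ D
satC-mono C⊆D sat with x , x∈ , px ← find sat = lose (C⊆D x x∈) px

⊨-mono : ∀ {S C D} → S ⊨ C → C ⊆ D → S ⊨ D
⊨-mono S⊨C C⊆D φ sat = satC-mono C⊆D (S⊨C φ sat)

Agree : List Var → Assignment → Assignment → Set
Agree vs φ ψ = ∀ v → v ∈ vs → φ v ≡ ψ v

_[_≔_] : Assignment → Var → Bool → Assignment
(φ [ v ≔ b ]) w with w ℕ.≟ v
... | yes _ = b
... | no _  = φ w

[≔]-agree : ∀ {vs φ ψ v} b → Agree vs φ ψ → Agree (v ∷ vs) (φ [ v ≔ b ]) (ψ [ v ≔ b ])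
[≔]-agree {v = v} b φ≗ψ w w∈ with w ℕ.≟ v | w∈
... | yes _   | _          = refl
... | no w≢v  | here w≡v   = ⊥-elim (w≢v w≡v)
... | no _    | there w∈′  = φ≗ψ w w∈′

[≔]-id : ∀ {vs φ v b} → φ v ≡ b → Agree vs (φ [ v ≔ b ]) φ
[≔]-id {v = v} φv≡b w _ with w ℕ.≟ v
... | yes refl = sym φv≡b
... | no _     = refl

-- A property of assignments that only looks at the variables vs is decided by
-- checking the 2^|vs| assignments that are constantly false outside vs.
∀-assignment? : (vs : List Var) {P : Assignment → Set} → (∀ φ → Dec (P φ)) →
                (∀ {φ ψ} → Agree vs φ ψ → P φ → P ψ) → Dec (∀ φ → P φ)
∀-assignment? [] P? resp =
  map′ (λ p _ → resp (λ _ ()) p) (λ all → all (λ _ → false)) (P? (λ _ → false))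
∀-assignment? (v ∷ vs) {P} P? resp =
  map′ (λ both φ → from-both φ (both φ)) (λ all _ → all _ , all _)
       (∀-assignment? vs (λ φ → P? _ ×-dec P? _)
          (λ φ≗ψ (p , q) → resp ([≔]-agree true φ≗ψ) p , resp ([≔]-agree false φ≗ψ) q))
  where
  from-both : ∀ φ → P (φ [ v ≔ true ]) × P (φ [ v ≔ false ]) → P φ
  from-both φ (p , q) with φ v in φv
  ... | true  = resp ([≔]-id φv) p
  ... | false = resp ([≔]-id φv) q

vars : List (List Lit) → List Var
vars = concatMap (map Lit.var)

satC-agree : ∀ {Cs C φ ψ} → C ∈ Cs → Agree (vars Cs) φ ψ → satC φ C → satC ψ C
satC-agree {φ = φ} {ψ} C∈ φ≗ψ sat with l , l∈ , φl ← find sat =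
  lose l∈ (agree-lit {φ} {ψ} l (φ≗ψ _ (∈-concat⁺′ (∈-map⁺ Lit.var l∈) (∈-map⁺ (map Lit.var) C∈))) φl)
  where
  agree-lit : ∀ {φ ψ} l → φ (Lit.var l) ≡ ψ (Lit.var l) → evalLit φ l → evalLit ψ l
  agree-lit (lit v s) φv≡ψv φv≡s = trans (sym φv≡ψv) φv≡s

satS? : ∀ φ F → Dec (satS φ ⟦ F ⟧)
satS? φ F = map′ (λ all _ → lookup all) (λ sat → tabulate (sat _)) (all? (satC? φ) (clauses F))

_⊨?_ : (F : ClauseSet) (E : List Lit) → Dec (⟦ F ⟧ ⊨ E)
F ⊨? E = ∀-assignment? (vars (E ∷ clauses F)) (λ φ → satS? φ F →-dec satC? φ E) respects
  where
  respects : ∀ {φ ψ} → Agree (vars (E ∷ clauses F)) φ ψ →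
             (satS φ ⟦ F ⟧ → satC φ E) → satS ψ ⟦ F ⟧ → satC ψ E
  respects φ≗ψ entails satψ = satC-agree {E ∷ clauses F} (here refl) φ≗ψ
    (entails λ C C∈ → satC-agree {E ∷ clauses F} (there C∈) (λ v v∈ → sym (φ≗ψ v v∈)) (satψ C C∈))

Avoidable : ClauseSet → List Lit → List Lit → Set
Avoidable F C X = Σ (List Lit) λ E → E ⊆ X × ⟦ F ⟧ ⊨ E × ¬ C ⊆ E

Unavoidable : ClauseSet → List Lit → List Lit → Set
Unavoidable F C X = ∀ E → E ⊆ X → ⟦ F ⟧ ⊨ E → C ⊆ E

-- It suffices to search the sublists of X: an implicate E inside X can be replaced
-- by the sublist restrict X E, which contains E and is contained in it.
avoidable⊎unavoidable : ∀ F C X → Avoidable F C X ⊎ Unavoidable F C X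
avoidable⊎unavoidable F C X with any? (λ E → (F ⊨? E) ×-dec ¬? (C ⊆? E)) (sublists X)
... | yes some with E , E∈ , ⊨E , C⊈E ← find some = inj₁ (E , ∈sublists⇒⊆ X E∈ , ⊨E , C⊈E)
... | no none = inj₂ λ E E⊆X ⊨E →
  ⊆-trans (decidable-stable (C ⊆? restrict X E) λ C⊈ →
             none (lose (filter∈sublists (_∈? E) X) (⊨-mono ⊨E (⊆-restrict E⊆X) , C⊈)))
          (restrict-⊆ʳ X E)

unavoidable? : ∀ F C X → Dec (Unavoidable F C X)
unavoidable? F C X with avoidable⊎unavoidable F C X
... | inj₁ (E , E⊆X , ⊨E , C⊈E) = no λ unavoidable → C⊈E (unavoidable E E⊆X ⊨E)
... | inj₂ unavoidable = yes unavoidable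

¬unavoidable⇒avoidable : ∀ {F C X} → ¬ Unavoidable F C X → Avoidable F C X
¬unavoidable⇒avoidable {F} {C} {X} ¬unavoidable with avoidable⊎unavoidable F C X
... | inj₁ avoidable   = avoidable
... | inj₂ unavoidable = ⊥-elim (¬unavoidable unavoidable)

prime-implicate-⊆ : (F : ClauseSet) {D : List Lit} → IsClause D → ⟦ F ⟧ ⊨ D →
                    Σ (List Lit) λ E → E ⊆ D × IsPrime ⟦ F ⟧ E
prime-implicate-⊆ F {D} = go D (<-wellFounded (length D))
  where
  go : ∀ D → Acc _<_ (length D) → IsClause D → ⟦ F ⟧ ⊨ D →
       Σ (List Lit) λ E → E ⊆ D × IsPrime ⟦ F ⟧ E
  go D (acc smaller) clD ⊨D with avoidable⊎unavoidable F D D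
  ... | inj₂ minimal = D , ⊆-refl , clD , ⊨D , λ D′ D′⊆D D⊈D′ ⊨D′ → D⊈D′ (minimal D′ D′⊆D ⊨D′)
  ... | inj₁ (E , E⊆D , ⊨E , D⊈E)
    with E′ , E′⊆ , primeE′ ← go (restrict D E) (smaller (restrict-< D⊈E))
                                 (restrict-clause E clD) (⊨-mono ⊨E (⊆-restrict E⊆D)) =
    E′ , ⊆-trans E′⊆ (restrict-⊆ˡ D E) , primeE′

_⊨ˢ_ : CSet → CSet → Set
S ⊨ˢ T = ∀ φ → satS φ S → satS φ T

⊨ˢ-trans : ∀ {S T U} → S ⊨ˢ T → T ⊨ˢ U → S ⊨ˢ U
⊨ˢ-trans S⊨T T⊨U φ sat = T⊨U φ (S⊨T φ sat)

⊨-⊨ˢ : ∀ {S T C} → S ⊨ˢ T → T ⊨ C → S ⊨ C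
⊨-⊨ˢ S⊨T T⊨C φ sat = T⊨C φ (S⊨T φ sat)

IsPrime-⊨ˢ : ∀ {S T C} → S ⊨ˢ T → T ⊨ˢ S → IsPrime S C → IsPrime T C
IsPrime-⊨ˢ S⊨T T⊨S (clC , S⊨C , minimal) =
  clC , ⊨-⊨ˢ T⊨S S⊨C , λ D D⊆C C⊈D T⊨D → minimal D D⊆C C⊈D (⊨-⊨ˢ S⊨T T⊨D)

⊨ˢ⇒Equiv : ∀ {S T} → S ⊨ˢ T → T ⊨ˢ S → Equiv S T
⊨ˢ⇒Equiv S⊨T T⊨S C = mk⇔ (IsPrime-⊨ˢ S⊨T T⊨S) (IsPrime-⊨ˢ T⊨S S⊨T)

primes-⊨ˢ : ∀ {S} (F : ClauseSet) → (∀ E → IsPrime ⟦ F ⟧ E → S ⊨ E) → S ⊨ˢ ⟦ F ⟧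
primes-⊨ˢ F S⊨primes φ sat B B∈
  with E , E⊆B , primeE ← prime-implicate-⊆ F (lookup (allCl F) B∈) (λ _ satF → satF B B∈) =
  satC-mono E⊆B (S⊨primes E primeE φ sat)

Equiv⇒⊨ˢ : ∀ F F′ → Equiv ⟦ F ⟧ ⟦ F′ ⟧ → ⟦ F ⟧ ⊨ˢ ⟦ F′ ⟧
Equiv⇒⊨ˢ F F′ F≡F′ = primes-⊨ˢ F′ λ E primeE → proj₁ (proj₂ (Equivalence.from (F≡F′ E) primeE))

all-avoidable⇒inessential : ∀ F F′ {C} → Equiv ⟦ F ⟧ ⟦ F′ ⟧ →
                            (∀ X → X ∈ clauses F′ → Avoidable F C X) → Equiv (prcMinus F C) ⟦ F ⟧
all-avoidable⇒inessential F F′ {C} F≡F′ avoidable =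
  ⊨ˢ⇒Equiv (⊨ˢ-trans prc∖C⊨F′ (Equiv⇒⊨ˢ F′ F λ E → ⇔.sym (F≡F′ E))) F⊨prc∖C
  where
  F⊨prc∖C : ⟦ F ⟧ ⊨ˢ prcMinus F C
  F⊨prc∖C φ sat E (primeE , _) = proj₁ (proj₂ primeE) φ sat

  prc∖C⊨F′ : prcMinus F C ⊨ˢ ⟦ F′ ⟧
  prc∖C⊨F′ φ sat X X∈
    with E , E⊆X , ⊨E , C⊈E ← avoidable X X∈
    with E′ , E′⊆ , primeE′ ← prime-implicate-⊆ F (restrict-clause E (lookup (allCl F′) X∈))
                                                   (⊨-mono ⊨E (⊆-restrict E⊆X)) =
    satC-mono (⊆-trans E′⊆ (restrict-⊆ˡ X E))
      (sat E′ (primeE′ , λ E′≈C → C⊈E (⊆-trans (proj₂ E′≈C) (⊆-trans E′⊆ (restrict-⊆ʳ X E)))))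

essential⇒unavoidable : ∀ F F′ {C} → Equiv ⟦ F ⟧ ⟦ F′ ⟧ → Essential F C →
                        Σ (List Lit) λ X → X ∈ clauses F′ × Unavoidable F C X
essential⇒unavoidable F F′ {C} F≡F′ (_ , ¬inessential) with any? (unavoidable? F C) (clauses F′)
... | yes some = find some
... | no none  = ⊥-elim (¬inessential (all-avoidable⇒inessential F F′ F≡F′
                   λ X X∈ → ¬unavoidable⇒avoidable {F} {C} {X} λ unavoidable → none (lose X∈ unavoidable)))

module EssentialImage (F F′ : ClauseSet) (F≡F′ : Equiv ⟦ F ⟧ ⟦ F′ ⟧) where

  image : (C : List Lit) → Essential F C → List Lit
  image C e = proj₁ (essential⇒unavoidable F F′ F≡F′ e)

  image∈F′ : (C : List Lit) (e : Essential F C) → image C e ∈ clauses F′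
  image∈F′ C e = proj₁ (proj₂ (essential⇒unavoidable F F′ F≡F′ e))

  unavoidable-image : (C : List Lit) (e : Essential F C) → Unavoidable F C (image C e)
  unavoidable-image C e = proj₂ (proj₂ (essential⇒unavoidable F F′ F≡F′ e))

  ⊆image : (C : List Lit) (e : Essential F C) → C ⊆ image C e
  ⊆image C e = unavoidable-image C e (image C e) ⊆-refl
                 (λ φ sat → Equiv⇒⊨ˢ F F′ F≡F′ φ sat (image C e) (image∈F′ C e))

  image-⊆⇒⊆ : ∀ C D (e : Essential F C) (e′ : Essential F D) → image D e′ ⊆ image C e → C ⊆ D
  image-⊆⇒⊆ C D e e′ iD⊆iC =
    unavoidable-image C e D (⊆-trans (⊆image D e′) iD⊆iC) (proj₁ (proj₂ (proj₁ e′)))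

  image-injective : ∀ C D (e : Essential F C) (e′ : Essential F D) → image C e ≈ image D e′ → C ≈ D
  image-injective C D e e′ (iC⊆iD , iD⊆iC) = image-⊆⇒⊆ C D e e′ iD⊆iC , image-⊆⇒⊆ D C e′ e iC⊆iD

lemma2p1 : (F F′ : ClauseSet) → Equiv ⟦ F ⟧ ⟦ F′ ⟧ →
    (Σ ((C : List Lit) → Essential F C → List Lit) λ i →
        ((C : List Lit) (e : Essential F C) → i C e ∈ clauses F′)
      × ((C : List Lit) (e : Essential F C) → C ⊆ i C e)
      × ((C D : List Lit) (e : Essential F C) (e′ : Essential F D) → i C e ≈ i D e′ → C ≈ D))
    × ((Ps : List (List Lit)) → AllPairs (λ C D → ¬ (C ≈ D)) Ps → All (Essential F) Ps → length Ps ≤ c F′)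
lemma2p1 F F′ F≡F′ =
  (image , image∈F′ , ⊆image , image-injective) ,
  λ Ps distinct essential →
    injection⇒length-≤ (λ {C} → image C) (image∈F′ _)
      (λ e e′ iC≡iD → image-injective _ _ e e′ (≡⇒≈ iC≡iD)) distinct essential
  where open EssentialImage F F′ F≡F′
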